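{- Let $k\geq 2$. Then: (1) $p_2(n)=1$ if $n\geq 0$ is even and $p_2(n)=0$ if $n$ is odd. (2) For $n\geq 0$, $p_3(n)=\lfloor n/6\rfloor+1$ if $n\not\equiv 1\pmod 6$, and $p_3(n)=\lfloor n/6\rfloor$ if $n\equiv 1\pmod 6$. (3) For integers $a\geq 0$: $p_4(n)=3a^2+3a+1$ if $n=12a$ or $n=12a+3$; $p_4(n)=3a^2+4a+1$ if $n=12a+2$ or $n=12a+5$; $p_4(n)=3a^2+5a+2$ if $n=12a+4$ or $n=12a+7$; $p_4(n)=3a^2+6a+3$ if $n=12a+6$ or $n=12a+9$; $p_4(n)=3a^2+7a+4$ if $n=12a+8$ or $n=12a+11$; $p_4(n)=3a^2+8a+5$ if $n=12a+10$ or $n=12a+13$. (4) In general, \[\sum_{n\geq 0}p_k(n)q^n=\frac{1}{(q^2;q)_{k-1}}=1+\sum_{j=2}^k\frac{q^j}{(q^j;q)_{k-j+1}}=1-q+\frac{q}{(q^2;q)_{k-2}}+\sum_{j=1}^{k}\frac{q^{2j}}{(q^2;q)_{j-1}}\] \[=q^k+\frac{1}{(q^2;q)_{k-2}}+\frac{q^{2k}}{(q^2;q)_{k-1}}+\sum_{j=2}^{k-1}\frac{q^{k+j}}{(q^2;q)_{j-1}}.\]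
   Context: For $k\geq 2$, $p_k(n)$ denotes the number of partitions of $n$ with at most $k$ parts in which the largest part appears at least twice; by convention $p_k(0)=1$ and $p_k(n)=0$ when $n=1$ or $n<0$. The $q$-Pochhammer symbol is $(a;q)_j=\prod_{i=0}^{j-1}(1-aq^i)$ with $(a;q)_0=1$. -}

module Defs where

open import Data.Nat as ℕ using (ℕ; zero; suc; _∸_; _≤_; _<_; _≥_)
open import Data.Nat.Divisibility using (_∣?_)
open import Data.Integer as ℤ using (ℤ; +_)
open import Data.List using (List; []; _∷_; length; map; upTo; foldr)
open import Data.List.Relation.Unary.All using (All)
open import Data.List.Relation.Unary.Linked using (Linked)
open import Data.Product using (Σ; ∃; _×_)
open import Data.Sum using (_⊎_)
open import Relation.Binary.PropositionalEquality using (_≡_)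
open import Relation.Nullary.Decidable using (⌊_⌋)
open import Data.Bool using (if_then_else_)
open import Data.Nat using (_≟_)
open import Data.Nat.ListAction using (sum)

-- The empty partition (n = 0) is included,
-- matching the convention p_k(0) = 1.
LargestTwice : List ℕ → Set
LargestTwice xs = xs ≡ [] ⊎ ∃ λ a → ∃ λ rest → xs ≡ a ∷ a ∷ rest

record PkPartition (k n : ℕ) : Set where
  constructor mkPart
  field
    parts        : List ℕ
    positive     : All (λ x → 1 ≤ x) parts
    nonincreasing : Linked _≥_ parts
    atMostK      : length parts ≤ k
    sumIsN       : sum parts ≡ n
    largestTwice : LargestTwice parts

Series : Set
Series = ℕ → ℤ

_≈_ : Series → Series → Set
f ≈ g = ∀ n → f n ≡ g n
infix 4 _≈_

0s 1s : Series
0s n = + 0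
1s zero = + 1
1s (suc n) = + 0

qpow : ℕ → Series
qpow d n = if ⌊ n ≟ d ⌋ then + 1 else + 0

_⊕_ _⊖_ _⊛_ : Series → Series → Series
(f ⊕ g) n = f n ℤ.+ g n
(f ⊖ g) n = f n ℤ.- g n
(f ⊛ g) n = foldr ℤ._+_ (+ 0) (map (λ i → f i ℤ.* g (n ∸ i)) (upTo (suc n)))
infixl 6 _⊕_ _⊖_
infixl 7 _⊛_

-- 1/(1 - q^i) = Σ_{m ≥ 0} q^{i m}  (used only for i ≥ 1)
geom : ℕ → Series
geom i n = if ⌊ i ∣? n ⌋ then + 1 else + 0

-- 1/(q^a;q)_m = ∏_{i=0}^{m-1} 1/(1 - q^{a+i})   (used only for a ≥ 1)
invPoch : ℕ → ℕ → Series
invPoch a zero = 1s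
invPoch a (suc m) = invPoch a m ⊛ geom (a ℕ.+ m)

-- Σ_{j=a}^{b} F j  (empty when b < a)
sumFromTo : ℕ → ℕ → (ℕ → Series) → Series
sumFromTo a b F = foldr (λ j s → F j ⊕ s) 0s (map (a ℕ.+_) (upTo (suc b ∸ a)))

-- Removing the first column of a partition with exactly k ≥ 2 parts (largest part repeated)
-- leaves such a partition of n − k with at most k parts, so p_k(n) = p_{k−1}(n) + p_k(n − k)
-- for n ≥ k and p_k(n) = p_{k−1}(n) for n < k.  For the generating functions this says
-- P_k = P_{k−1} + q^k P_k.  Such an equation determines its solution coefficient by
-- coefficient, and 1/(q²;q)_{k−1} satisfies the same one, so P_k = 1/(q²;q)_{k−1} by
-- induction on k.  The other expansions come from the analogous functional equations of
-- 1/(q^a;q)_m, and (1)–(3) from solving the recurrence explicitly for k = 2, 3, 4.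

module Submission where

open import Defs
open import Data.Nat using (ℕ; zero; suc; pred; _+_; _*_; _∸_; _≤_; _<_; _≥_; _≤?_; z≤n; s≤s; _/_; _%_)
import Data.Nat.Properties as ℕ
open import Data.Nat.Divisibility using (_∣?_; _∣_; _∣0; ∣-refl; ∣m∣n⇒∣m+n; ∣m+n∣m⇒∣n; >⇒∤)
open import Data.Nat.DivMod using (m/n≡1+[m∸n]/n; m%n<n)
open import Data.Nat.Induction using (<-wellFounded)
open import Data.Nat.ListAction using (sum)
import Data.Nat.Tactic.RingSolver as ℕ-Ring
open import Data.Integer using (ℤ; +_)
import Data.Integer as ℤ
import Data.Integer.Properties as ℤ
open import Algebra.Properties.CommutativeSemigroup ℤ.+-commutativeSemigroup
  using () renaming (interchange to +-interchange)
import Data.Integer.Tactic.RingSolver as ℤ-Ring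
open import Data.List using (List; []; _∷_; length; map; foldr; applyUpTo)
open import Data.List.Properties using (≡-dec; ∷-injectiveˡ; ∷-injectiveʳ)
open import Data.List.Relation.Unary.All as All using (All; []; _∷_)
open import Data.List.Relation.Unary.Linked as Linked using (Linked; []; [-]; _∷_)
open import Data.List.Relation.Unary.Linked.Properties using (Linked⇒All)
open import Data.Fin using (Fin)
import Data.Fin as Fin
open import Data.Fin.Properties using (+↔⊎)
open import Data.Fin.Permutation using (↔⇒≡)
open import Data.Product using (_×_; _,_)
open import Data.Sum using (_⊎_; inj₁; inj₂)
open import Data.Sum.Function.Propositional using (_⊎-↔_)
open import Data.Empty using (⊥; ⊥-elim)
open import Function using (_∘_)
open import Function.Bundles using (_↔_; mk↔ₛ′)
open import Function.Properties.Inverse using (↔-sym; ↔-trans)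
open import Induction.WellFounded using (Acc; acc)
open import Relation.Nullary using (yes; no; ¬_; Dec; contradiction)
open import Relation.Binary.PropositionalEquality
open import Axiom.UniquenessOfIdentityProofs using (module Decidable⇒UIP)
import Relation.Binary.Reasoning.Setoid as SetoidReasoning

open PkPartition

∑< : ℕ → (ℕ → ℤ) → ℤ
∑< zero    g = + 0
∑< (suc n) g = g 0 ℤ.+ ∑< n (g ∘ suc)

syntax ∑< n (λ i → e) = ∑[ i < n ] e

foldr-map-applyUpTo : ∀ (g : ℕ → ℤ) (f : ℕ → ℕ) n →
  foldr ℤ._+_ (+ 0) (map g (applyUpTo f n)) ≡ ∑< n (g ∘ f)
foldr-map-applyUpTo g f zero    = refl
foldr-map-applyUpTo g f (suc n) = cong (ℤ._+_ (g (f 0))) (foldr-map-applyUpTo g (f ∘ suc) n)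

∑<-cong : ∀ n {g h : ℕ → ℤ} → (∀ i → i < n → g i ≡ h i) → ∑< n g ≡ ∑< n h
∑<-cong zero    eq = refl
∑<-cong (suc n) eq = cong₂ ℤ._+_ (eq 0 (s≤s z≤n)) (∑<-cong n (λ i i<n → eq (suc i) (s≤s i<n)))

∑<-zero : ∀ n → ∑[ i < n ] (+ 0) ≡ + 0
∑<-zero zero    = refl
∑<-zero (suc n) = trans (ℤ.+-identityˡ _) (∑<-zero n)

∑<-snoc : ∀ n g → ∑< (suc n) g ≡ ∑< n g ℤ.+ g n
∑<-snoc zero    g = ℤ.+-comm (g 0) (+ 0)
∑<-snoc (suc n) g = begin
  g 0 ℤ.+ ∑< (suc n) (g ∘ suc)       ≡⟨ cong (ℤ._+_ (g 0)) (∑<-snoc n (g ∘ suc)) ⟩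
  g 0 ℤ.+ (∑< n (g ∘ suc) ℤ.+ g (suc n)) ≡⟨ ℤ.+-assoc (g 0) _ _ ⟨
  ∑< (suc n) g ℤ.+ g (suc n)         ∎
  where open ≡-Reasoning

∑<-+ : ∀ n g h → ∑[ i < n ] (g i ℤ.+ h i) ≡ ∑< n g ℤ.+ ∑< n h
∑<-+ zero    g h = refl
∑<-+ (suc n) g h = trans (cong (ℤ._+_ (g 0 ℤ.+ h 0)) (∑<-+ n (g ∘ suc) (h ∘ suc)))
                         (+-interchange (g 0) (h 0) (∑< n (g ∘ suc)) (∑< n (h ∘ suc)))

-- Formal power series

module ≈-Reasoning = SetoidReasoning (ℕ →-setoid ℤ)

≈-sym : ∀ {f g} → f ≈ g → g ≈ f
≈-sym f≈g n = sym (f≈g n)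

≈-trans : ∀ {f g h} → f ≈ g → g ≈ h → f ≈ h
≈-trans f≈g g≈h n = trans (f≈g n) (g≈h n)

⊕-cong : ∀ {f f′ g g′} → f ≈ f′ → g ≈ g′ → f ⊕ g ≈ f′ ⊕ g′
⊕-cong f≈f′ g≈g′ n = cong₂ ℤ._+_ (f≈f′ n) (g≈g′ n)

⊕-congˡ : ∀ f {g g′} → g ≈ g′ → f ⊕ g ≈ f ⊕ g′
⊕-congˡ f g≈g′ n = cong (ℤ._+_ (f n)) (g≈g′ n)

⊕-congʳ : ∀ {f f′} g → f ≈ f′ → f ⊕ g ≈ f′ ⊕ g
⊕-congʳ g f≈f′ n = cong (ℤ._+ g n) (f≈f′ n)

⊕-interchange : ∀ f g h k → (f ⊕ g) ⊕ (h ⊕ k) ≈ (f ⊕ h) ⊕ (g ⊕ k)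
⊕-interchange f g h k n = +-interchange (f n) (g n) (h n) (k n)

∑ˢ : ℕ → (ℕ → Series) → Series
∑ˢ m F n = ∑[ i < m ] F i n

∑ˢ-cong : ∀ m {F G} → (∀ i → F i ≈ G i) → ∑ˢ m F ≈ ∑ˢ m G
∑ˢ-cong m F≈G n = ∑<-cong m (λ i _ → F≈G i n)

∑ˢ-snoc : ∀ m F → ∑ˢ (suc m) F ≈ ∑ˢ m F ⊕ F m
∑ˢ-snoc m F n = ∑<-snoc m (λ i → F i n)

sumFromTo≈∑ˢ : ∀ a b F → sumFromTo a b F ≈ ∑ˢ (suc b ∸ a) (λ i → F (a + i))
sumFromTo≈∑ˢ a b F = go (_+_ a) (λ i → i) (suc b ∸ a)
  where
  go : ∀ g f m → foldr (λ j s → F j ⊕ s) 0s (map g (applyUpTo f m)) ≈ ∑ˢ m (F ∘ g ∘ f)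
  go g f zero    n = refl
  go g f (suc m) n = cong (ℤ._+_ (F (g (f 0)) n)) (go g (f ∘ suc) m n)

shift : ℕ → Series → Series
shift zero    f n       = f n
shift (suc d) f zero    = + 0
shift (suc d) f (suc n) = shift d f n

shift-+ : ∀ d f n → shift d f (d + n) ≡ f n
shift-+ zero    f n = refl
shift-+ (suc d) f n = shift-+ d f n

shift-< : ∀ d f {n} → n < d → shift d f n ≡ + 0
shift-< (suc d) f {zero}  _         = refl
shift-< (suc d) f {suc n} (s≤s n<d) = shift-< d f n<d

shift-cong : ∀ d {f g} → f ≈ g → shift d f ≈ shift d g
shift-cong zero    eq n       = eq n
shift-cong (suc d) eq zero    = refl
shift-cong (suc d) eq (suc n) = shift-cong d eq n

shift-cong≤ : ∀ d {f g} n → (∀ m → m ≤ n → f m ≡ g m) → shift d f n ≡ shift d g n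
shift-cong≤ zero    n       eq = eq n ℕ.≤-refl
shift-cong≤ (suc d) zero    eq = refl
shift-cong≤ (suc d) (suc n) eq = shift-cong≤ d n (λ m m≤n → eq m (ℕ.m≤n⇒m≤1+n m≤n))

shift-⊕ : ∀ d f g → shift d (f ⊕ g) ≈ shift d f ⊕ shift d g
shift-⊕ zero    f g n       = refl
shift-⊕ (suc d) f g zero    = refl
shift-⊕ (suc d) f g (suc n) = shift-⊕ d f g n

shift-shift : ∀ a b f → shift a (shift b f) ≈ shift (a + b) f
shift-shift zero    b f n       = refl
shift-shift (suc a) b f zero    = refl
shift-shift (suc a) b f (suc n) = shift-shift a b f n

shift-twice : ∀ d f → shift d (shift d f) ≈ shift (2 * d) f
shift-twice d f n = trans (shift-shift d d f n) (cong (λ e → shift (d + e) f n) (sym (ℕ.+-identityʳ d)))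

shift-comm : ∀ a b f → shift a (shift b f) ≈ shift b (shift a f)
shift-comm a b f n = begin
  shift a (shift b f) n ≡⟨ shift-shift a b f n ⟩
  shift (a + b) f n   ≡⟨ cong (λ d → shift d f n) (ℕ.+-comm a b) ⟩
  shift (b + a) f n   ≡⟨ shift-shift b a f n ⟨
  shift b (shift a f) n ∎
  where open ≡-Reasoning

shift-∑ˢ : ∀ d m F → shift d (∑ˢ m F) ≈ ∑ˢ m (λ i → shift d (F i))
shift-∑ˢ zero    m F n       = refl
shift-∑ˢ (suc d) m F zero    = sym (∑<-zero m)
shift-∑ˢ (suc d) m F (suc n) = shift-∑ˢ d m F n

data Offset (d : ℕ) : ℕ → Set where
  below : ∀ {n} → n < d → Offset d n
  above : ∀ r → Offset d (d + r)

offset : ∀ d n → Offset d n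
offset zero    n       = above n
offset (suc d) zero    = below (s≤s z≤n)
offset (suc d) (suc n) with offset d n
... | below n<d = below (s≤s n<d)
... | above r   = above r

-- Coefficient n of a solution of F = A + q^(d+1) F is determined by A and the coefficients below n.
shift-fixpoint-unique : ∀ d A {F G} →
  F ≈ A ⊕ shift (suc d) F → G ≈ A ⊕ shift (suc d) G → F ≈ G
shift-fixpoint-unique d A {F} {G} F≈ G≈ n = go n (<-wellFounded n)
  where
  go : ∀ n → Acc _<_ n → F n ≡ G n
  go n rs = trans (F≈ n) (trans (cong (ℤ._+_ (A n)) (shifted n rs)) (sym (G≈ n)))
    where
    shifted : ∀ n → Acc _<_ n → shift (suc d) F n ≡ shift (suc d) G n
    shifted zero    _         = refl
    shifted (suc m) (acc rec) = shift-cong≤ d m (λ j j≤m → go j (rec (s≤s j≤m)))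

⊛-∑ : ∀ f g n → (f ⊛ g) n ≡ ∑[ i < suc n ] (f i ℤ.* g (n ∸ i))
⊛-∑ f g n = foldr-map-applyUpTo (λ i → f i ℤ.* g (n ∸ i)) (λ i → i) (suc n)

⊛-unfoldˡ : ∀ f g n → (f ⊛ g) (suc n) ≡ f 0 ℤ.* g (suc n) ℤ.+ ((f ∘ suc) ⊛ g) n
⊛-unfoldˡ f g n = trans (⊛-∑ f g (suc n)) (cong (ℤ._+_ (f 0 ℤ.* g (suc n))) (sym (⊛-∑ (f ∘ suc) g n)))

⊛-unfoldʳ : ∀ f g n → (f ⊛ g) (suc n) ≡ (f ⊛ (g ∘ suc)) n ℤ.+ f (suc n) ℤ.* g 0
⊛-unfoldʳ f g n = begin
  (f ⊛ g) (suc n)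
    ≡⟨ ⊛-∑ f g (suc n) ⟩
  ∑[ i < suc (suc n) ] (f i ℤ.* g (suc n ∸ i))
    ≡⟨ ∑<-snoc (suc n) (λ i → f i ℤ.* g (suc n ∸ i)) ⟩
  ∑[ i < suc n ] (f i ℤ.* g (suc n ∸ i)) ℤ.+ f (suc n) ℤ.* g (n ∸ n)
    ≡⟨ cong₂ ℤ._+_ (∑<-cong (suc n) (λ i i≤n → cong (λ m → f i ℤ.* g m) (ℕ.+-∸-assoc 1 (ℕ.≤-pred i≤n))))
                   (cong (λ m → f (suc n) ℤ.* g m) (ℕ.n∸n≡0 n)) ⟩
  ∑[ i < suc n ] (f i ℤ.* g (suc (n ∸ i))) ℤ.+ f (suc n) ℤ.* g 0
    ≡⟨ cong (ℤ._+ f (suc n) ℤ.* g 0) (⊛-∑ f (g ∘ suc) n) ⟨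
  (f ⊛ (g ∘ suc)) n ℤ.+ f (suc n) ℤ.* g 0
    ∎
  where open ≡-Reasoning

⊛-congˡ : ∀ {f g} h → f ≈ g → f ⊛ h ≈ g ⊛ h
⊛-congˡ {f} {g} h f≈g n = begin
  (f ⊛ h) n                          ≡⟨ ⊛-∑ f h n ⟩
  ∑[ i < suc n ] (f i ℤ.* h (n ∸ i)) ≡⟨ ∑<-cong (suc n) (λ i _ → cong (ℤ._* h (n ∸ i)) (f≈g i)) ⟩
  ∑[ i < suc n ] (g i ℤ.* h (n ∸ i)) ≡⟨ ⊛-∑ g h n ⟨
  (g ⊛ h) n                          ∎
  where open ≡-Reasoning

⊛-congʳ : ∀ f {g h} → g ≈ h → f ⊛ g ≈ f ⊛ h
⊛-congʳ f {g} {h} g≈h n = begin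
  (f ⊛ g) n                          ≡⟨ ⊛-∑ f g n ⟩
  ∑[ i < suc n ] (f i ℤ.* g (n ∸ i)) ≡⟨ ∑<-cong (suc n) (λ i _ → cong (ℤ._*_ (f i)) (g≈h (n ∸ i))) ⟩
  ∑[ i < suc n ] (f i ℤ.* h (n ∸ i)) ≡⟨ ⊛-∑ f h n ⟨
  (f ⊛ h) n                          ∎
  where open ≡-Reasoning

⊛-distribˡ-⊕ : ∀ f g h → f ⊛ (g ⊕ h) ≈ f ⊛ g ⊕ f ⊛ h
⊛-distribˡ-⊕ f g h n = begin
  (f ⊛ (g ⊕ h)) n
    ≡⟨ ⊛-∑ f (g ⊕ h) n ⟩
  ∑[ i < suc n ] (f i ℤ.* (g (n ∸ i) ℤ.+ h (n ∸ i)))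
    ≡⟨ ∑<-cong (suc n) (λ i _ → ℤ.*-distribˡ-+ (f i) (g (n ∸ i)) (h (n ∸ i))) ⟩
  ∑[ i < suc n ] (f i ℤ.* g (n ∸ i) ℤ.+ f i ℤ.* h (n ∸ i))
    ≡⟨ ∑<-+ (suc n) (λ i → f i ℤ.* g (n ∸ i)) (λ i → f i ℤ.* h (n ∸ i)) ⟩
  ∑[ i < suc n ] (f i ℤ.* g (n ∸ i)) ℤ.+ ∑[ i < suc n ] (f i ℤ.* h (n ∸ i))
    ≡⟨ cong₂ ℤ._+_ (⊛-∑ f g n) (⊛-∑ f h n) ⟨
  (f ⊛ g ⊕ f ⊛ h) n
    ∎
  where open ≡-Reasoning

⊛-zeroˡ : ∀ f → 0s ⊛ f ≈ 0s
⊛-zeroˡ f n = begin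
  (0s ⊛ f) n                         ≡⟨ ⊛-∑ 0s f n ⟩
  ∑[ i < suc n ] (+ 0 ℤ.* f (n ∸ i)) ≡⟨ ∑<-cong (suc n) (λ i _ → ℤ.*-zeroˡ (f (n ∸ i))) ⟩
  ∑[ i < suc n ] (+ 0)               ≡⟨ ∑<-zero (suc n) ⟩
  + 0                                ∎
  where open ≡-Reasoning

⊛-zeroʳ : ∀ f → f ⊛ 0s ≈ 0s
⊛-zeroʳ f n = begin
  (f ⊛ 0s) n                    ≡⟨ ⊛-∑ f 0s n ⟩
  ∑[ i < suc n ] (f i ℤ.* + 0)  ≡⟨ ∑<-cong (suc n) (λ i _ → ℤ.*-zeroʳ (f i)) ⟩
  ∑[ i < suc n ] (+ 0)          ≡⟨ ∑<-zero (suc n) ⟩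
  + 0                           ∎
  where open ≡-Reasoning

⊛-identityˡ : ∀ f → 1s ⊛ f ≈ f
⊛-identityˡ f zero    = trans (ℤ.+-identityʳ _) (ℤ.*-identityˡ (f 0))
⊛-identityˡ f (suc n) = begin
  (1s ⊛ f) (suc n)                         ≡⟨ ⊛-unfoldˡ 1s f n ⟩
  + 1 ℤ.* f (suc n) ℤ.+ (0s ⊛ f) n         ≡⟨ cong₂ ℤ._+_ (ℤ.*-identityˡ (f (suc n))) (⊛-zeroˡ f n) ⟩
  f (suc n) ℤ.+ + 0                        ≡⟨ ℤ.+-identityʳ _ ⟩
  f (suc n)                                ∎
  where open ≡-Reasoning

⊛-identityʳ : ∀ f → f ⊛ 1s ≈ f
⊛-identityʳ f zero    = trans (ℤ.+-identityʳ _) (ℤ.*-identityʳ (f 0))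
⊛-identityʳ f (suc n) = begin
  (f ⊛ 1s) (suc n)                         ≡⟨ ⊛-unfoldʳ f 1s n ⟩
  (f ⊛ 0s) n ℤ.+ f (suc n) ℤ.* + 1         ≡⟨ cong₂ ℤ._+_ (⊛-zeroʳ f n) (ℤ.*-identityʳ (f (suc n))) ⟩
  + 0 ℤ.+ f (suc n)                        ≡⟨ ℤ.+-identityˡ _ ⟩
  f (suc n)                                ∎
  where open ≡-Reasoning

shift-⊛ : ∀ d f g → shift d f ⊛ g ≈ shift d (f ⊛ g)
shift-⊛ zero    f g n       = refl
shift-⊛ (suc d) f g zero    = trans (ℤ.+-identityʳ _) (ℤ.*-zeroˡ (g 0))
shift-⊛ (suc d) f g (suc n) = begin
  (shift (suc d) f ⊛ g) (suc n)                   ≡⟨ ⊛-unfoldˡ (shift (suc d) f) g n ⟩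
  + 0 ℤ.* g (suc n) ℤ.+ (shift d f ⊛ g) n         ≡⟨ cong₂ ℤ._+_ (ℤ.*-zeroˡ (g (suc n))) (shift-⊛ d f g n) ⟩
  + 0 ℤ.+ shift d (f ⊛ g) n                       ≡⟨ ℤ.+-identityˡ _ ⟩
  shift d (f ⊛ g) n                               ∎
  where open ≡-Reasoning

⊛-shift : ∀ d f g → f ⊛ shift d g ≈ shift d (f ⊛ g)
⊛-shift zero    f g n       = refl
⊛-shift (suc d) f g zero    = trans (ℤ.+-identityʳ _) (ℤ.*-zeroʳ (f 0))
⊛-shift (suc d) f g (suc n) = begin
  (f ⊛ shift (suc d) g) (suc n)                   ≡⟨ ⊛-unfoldʳ f (shift (suc d) g) n ⟩
  (f ⊛ shift d g) n ℤ.+ f (suc n) ℤ.* + 0         ≡⟨ cong₂ ℤ._+_ (⊛-shift d f g n) (ℤ.*-zeroʳ (f (suc n))) ⟩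
  shift d (f ⊛ g) n ℤ.+ + 0                       ≡⟨ ℤ.+-identityʳ _ ⟩
  shift d (f ⊛ g) n                               ∎
  where open ≡-Reasoning

qpow-diag : ∀ d → qpow d d ≡ + 1
qpow-diag d with d ℕ.≟ d
... | yes _   = refl
... | no d≢d = contradiction refl d≢d

qpow-≢ : ∀ d n → n ≢ d → qpow d n ≡ + 0
qpow-≢ d n n≢d with n ℕ.≟ d
... | yes n≡d = contradiction n≡d n≢d
... | no _    = refl

qpow-suc : ∀ d n → qpow (suc d) (suc n) ≡ qpow d n
qpow-suc d n with n ℕ.≟ d
... | yes refl = qpow-diag (suc n)
... | no n≢d   = qpow-≢ (suc d) (suc n) (n≢d ∘ ℕ.suc-injective)

qpow≈shift-1s : ∀ d → qpow d ≈ shift d 1s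
qpow≈shift-1s zero    zero    = qpow-diag 0
qpow≈shift-1s zero    (suc n) = qpow-≢ 0 (suc n) (λ ())
qpow≈shift-1s (suc d) zero    = qpow-≢ (suc d) 0 (λ ())
qpow≈shift-1s (suc d) (suc n) = trans (qpow-suc d n) (qpow≈shift-1s d n)

qpow-⊛ : ∀ d f → qpow d ⊛ f ≈ shift d f
qpow-⊛ d f = begin
  qpow d ⊛ f       ≈⟨ ⊛-congˡ f (qpow≈shift-1s d) ⟩
  shift d 1s ⊛ f   ≈⟨ shift-⊛ d 1s f ⟩
  shift d (1s ⊛ f) ≈⟨ shift-cong d (⊛-identityˡ f) ⟩
  shift d f        ∎
  where open ≈-Reasoning

sumFromTo-qpow-⊛ : ∀ a b (e : ℕ → ℕ) (F : ℕ → Series) →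
  sumFromTo a b (λ j → qpow (e j) ⊛ F j) ≈ ∑ˢ (suc b ∸ a) (λ i → shift (e (a + i)) (F (a + i)))
sumFromTo-qpow-⊛ a b e F =
  ≈-trans (sumFromTo≈∑ˢ a b (λ j → qpow (e j) ⊛ F j))
          (∑ˢ-cong (suc b ∸ a) (λ i → qpow-⊛ (e (a + i)) (F (a + i))))

geom-∣ : ∀ {i n} → i ∣ n → geom i n ≡ + 1
geom-∣ {i} {n} i∣n with i ∣? n
... | yes _  = refl
... | no i∤n = contradiction i∣n i∤n

geom-∤ : ∀ {i n} → ¬ i ∣ n → geom i n ≡ + 0
geom-∤ {i} {n} i∤n with i ∣? n
... | yes i∣n = contradiction i∣n i∤n
... | no _    = refl

geom-+ : ∀ i n → geom i (i + n) ≡ geom i n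
geom-+ i n with i ∣? n
... | yes i∣n = geom-∣ (∣m∣n⇒∣m+n ∣-refl i∣n)
... | no i∤n  = geom-∤ (λ i∣i+n → i∤n (∣m+n∣m⇒∣n i∣i+n ∣-refl))

geom-unfold : ∀ i → geom (suc i) ≈ 1s ⊕ shift (suc i) (geom (suc i))
geom-unfold i n with offset (suc i) n
... | below {zero} _          = trans (geom-∣ (suc i ∣0)) (sym (ℤ.+-identityʳ (+ 1)))
... | below {suc n} (s≤s n<i) =
  trans (geom-∤ (>⇒∤ (s≤s n<i))) (sym (trans (ℤ.+-identityˡ _) (shift-< i (geom (suc i)) n<i)))
... | above r                 =
  trans (geom-+ (suc i) r) (sym (trans (ℤ.+-identityˡ _) (shift-+ (suc i) (geom (suc i)) r)))

⊛-geom : ∀ f i → f ⊛ geom (suc i) ≈ f ⊕ shift (suc i) (f ⊛ geom (suc i))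
⊛-geom f i = begin
  f ⊛ geom (suc i)                                ≈⟨ ⊛-congʳ f (geom-unfold i) ⟩
  f ⊛ (1s ⊕ shift (suc i) (geom (suc i)))         ≈⟨ ⊛-distribˡ-⊕ f 1s (shift (suc i) (geom (suc i))) ⟩
  f ⊛ 1s ⊕ f ⊛ shift (suc i) (geom (suc i))       ≈⟨ ⊕-cong (⊛-identityʳ f) (⊛-shift (suc i) f (geom (suc i))) ⟩
  f ⊕ shift (suc i) (f ⊛ geom (suc i))            ∎
  where open ≈-Reasoning

-- Expansions of 1/(q^a;q)_m

invPoch-unfold : ∀ a m →
  invPoch (suc a) (suc m) ≈ invPoch (suc a) m ⊕ shift (suc a + m) (invPoch (suc a) (suc m))
invPoch-unfold a m = ⊛-geom (invPoch (suc a) m) (a + m)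

-- At m + 1 both sides solve F = invPoch (suc a) (suc m) ⊕ shift (suc a + suc m) F (the right one by the case m).
invPoch-peel : ∀ a m →
  invPoch (suc a) (suc m) ≈ invPoch (2 + a) m ⊕ shift (suc a) (invPoch (suc a) (suc m))
invPoch-peel a zero = subst (λ d → invPoch (suc a) 1 ≈ 1s ⊕ shift d (invPoch (suc a) 1))
                            (ℕ.+-identityʳ (suc a)) (invPoch-unfold a 0)
invPoch-peel a (suc m) = shift-fixpoint-unique (a + suc m) Z (invPoch-unfold a (suc m)) (≈-sym solves)
  where
  s : ℕ
  s = suc a + suc m
  X Y Z W : Series
  X = invPoch (suc a) (suc (suc m))
  Y = invPoch (2 + a) (suc m)
  Z = invPoch (suc a) (suc m)
  W = invPoch (2 + a) m
  Y-unfold : Y ≈ W ⊕ shift s Y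
  Y-unfold = subst (λ d → Y ≈ W ⊕ shift d Y) (sym (ℕ.+-suc (suc a) m)) (invPoch-unfold (suc a) m)
  open ≈-Reasoning
  solves : Z ⊕ shift s (Y ⊕ shift (suc a) X) ≈ Y ⊕ shift (suc a) X
  solves = begin
    Z ⊕ shift s (Y ⊕ shift (suc a) X)
      ≈⟨ ⊕-cong (invPoch-peel a m) (shift-⊕ s Y (shift (suc a) X)) ⟩
    (W ⊕ shift (suc a) Z) ⊕ (shift s Y ⊕ shift s (shift (suc a) X))
      ≈⟨ ⊕-interchange W (shift (suc a) Z) (shift s Y) (shift s (shift (suc a) X)) ⟩
    (W ⊕ shift s Y) ⊕ (shift (suc a) Z ⊕ shift s (shift (suc a) X))
      ≈⟨ ⊕-cong (≈-sym Y-unfold) (⊕-congˡ (shift (suc a) Z) (shift-comm s (suc a) X)) ⟩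
    Y ⊕ (shift (suc a) Z ⊕ shift (suc a) (shift s X))
      ≈⟨ ⊕-congˡ Y (≈-sym (shift-⊕ (suc a) Z (shift s X))) ⟩
    Y ⊕ shift (suc a) (Z ⊕ shift s X)
      ≈⟨ ⊕-congˡ Y (shift-cong (suc a) (≈-sym (invPoch-unfold a (suc m)))) ⟩
    Y ⊕ shift (suc a) X
      ∎

invPoch-expand : ∀ a m → invPoch (suc a) (suc m) ≈
  1s ⊕ ∑ˢ (suc m) (λ i → shift (suc a + i) (invPoch (suc a + i) (m ∸ i + 1)))
invPoch-expand a zero = ≈-trans (invPoch-peel a 0) (⊕-congˡ 1s last)
  where
  last : shift (suc a) (invPoch (suc a) 1) ≈ ∑ˢ 1 (λ i → shift (suc a + i) (invPoch (suc a + i) 1))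
  last n = trans (sym (ℤ.+-identityʳ _))
                 (cong (λ b → shift b (invPoch b 1) n ℤ.+ + 0) (sym (ℕ.+-identityʳ (suc a))))
invPoch-expand a (suc m) = begin
  invPoch (suc a) (suc (suc m))                     ≈⟨ invPoch-peel a (suc m) ⟩
  invPoch (2 + a) (suc m) ⊕ shift (suc a) X         ≈⟨ ⊕-congʳ (shift (suc a) X) (invPoch-expand (suc a) m) ⟩
  (1s ⊕ ∑ˢ (suc m) later) ⊕ shift (suc a) X         ≈⟨ (λ n → rotate (1s n) (∑ˢ (suc m) later n) (shift (suc a) X n)) ⟩
  1s ⊕ (shift (suc a) X ⊕ ∑ˢ (suc m) later)         ≈⟨ ⊕-congˡ 1s (⊕-cong first (∑ˢ-cong (suc m) rest)) ⟩
  1s ⊕ ∑ˢ (suc (suc m)) term                        ∎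
  where
  open ≈-Reasoning
  X : Series
  X = invPoch (suc a) (suc (suc m))
  term later : ℕ → Series
  term  i = shift (suc a + i) (invPoch (suc a + i) (suc m ∸ i + 1))
  later i = shift (2 + a + i) (invPoch (2 + a + i) (m ∸ i + 1))
  first : shift (suc a) X ≈ term 0
  first n = cong₂ (λ b r → shift b (invPoch b r) n) (sym (ℕ.+-identityʳ (suc a))) (cong suc (ℕ.+-comm 1 m))
  rest : ∀ i → later i ≈ term (suc i)
  rest i n = cong (λ b → shift b (invPoch b (m ∸ i + 1)) n) (sym (ℕ.+-suc (suc a) i))
  rotate : ∀ x y z → x ℤ.+ y ℤ.+ z ≡ x ℤ.+ (z ℤ.+ y)
  rotate = ℤ-Ring.solve-∀

invPoch2-telescope : ∀ m → invPoch 2 m ≈ 1s ⊕ ∑ˢ m (λ i → shift (2 + i) (invPoch 2 (suc i)))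
invPoch2-telescope zero    n = sym (ℤ.+-identityʳ (1s n))
invPoch2-telescope (suc m) = begin
  invPoch 2 (suc m)       ≈⟨ invPoch-unfold 1 m ⟩
  invPoch 2 m ⊕ H m       ≈⟨ ⊕-congʳ (H m) (invPoch2-telescope m) ⟩
  1s ⊕ ∑ˢ m H ⊕ H m       ≈⟨ (λ n → ℤ.+-assoc (1s n) (∑ˢ m H n) (H m n)) ⟩
  1s ⊕ (∑ˢ m H ⊕ H m)     ≈⟨ ⊕-congˡ 1s (≈-sym (∑ˢ-snoc m H)) ⟩
  1s ⊕ ∑ˢ (suc m) H       ∎
  where
  open ≈-Reasoning
  H : ℕ → Series
  H i = shift (2 + i) (invPoch 2 (suc i))

invPoch2-expand-squares : ∀ m → invPoch 2 (suc m) ≈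
  1s ⊖ qpow 1 ⊕ shift 1 (invPoch 2 m) ⊕ ∑ˢ (2 + m) (λ i → shift (2 * suc i) (invPoch 2 i))
invPoch2-expand-squares zero = begin
  G 1                                            ≈⟨ invPoch-unfold 1 0 ⟩
  1s ⊕ shift 2 (G 1)                             ≈⟨ ⊕-congˡ 1s (shift-cong 2 (invPoch-unfold 1 0)) ⟩
  1s ⊕ shift 2 (1s ⊕ shift 2 (G 1))              ≈⟨ ⊕-congˡ 1s (shift-⊕ 2 1s (shift 2 (G 1))) ⟩
  1s ⊕ (shift 2 1s ⊕ shift 2 (shift 2 (G 1)))    ≈⟨ ⊕-congˡ 1s (⊕-congˡ (shift 2 1s) (shift-twice 2 (G 1))) ⟩
  1s ⊕ (shift 2 1s ⊕ shift 4 (G 1))              ≈⟨ (λ n → insert (1s n) (qpow 1 n) (shift 2 1s n) (shift 4 (G 1) n)) ⟩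
  1s ⊖ qpow 1 ⊕ qpow 1 ⊕ ∑ˢ 2 F                  ≈⟨ ⊕-congʳ (∑ˢ 2 F) (⊕-congˡ (1s ⊖ qpow 1) (qpow≈shift-1s 1)) ⟩
  1s ⊖ qpow 1 ⊕ shift 1 1s ⊕ ∑ˢ 2 F              ∎
  where
  open ≈-Reasoning
  G : ℕ → Series
  G = invPoch 2
  F : ℕ → Series
  F i = shift (2 * suc i) (G i)
  insert : ∀ c q x y → c ℤ.+ (x ℤ.+ y) ≡ c ℤ.- q ℤ.+ q ℤ.+ (x ℤ.+ (y ℤ.+ + 0))
  insert = ℤ-Ring.solve-∀
invPoch2-expand-squares (suc m) = begin
  G (2 + m)
    ≈⟨ invPoch-unfold 1 (suc m) ⟩
  G (suc m) ⊕ shift (3 + m) (G (2 + m))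
    ≈⟨ ⊕-cong (invPoch2-expand-squares m) (shift-cong (3 + m) (invPoch-unfold 1 (suc m))) ⟩
  base ⊕ ∑ˢ (2 + m) F ⊕ shift (3 + m) (G (suc m) ⊕ shift (3 + m) (G (2 + m)))
    ≈⟨ ⊕-congˡ (base ⊕ ∑ˢ (2 + m) F) (≈-trans (shift-⊕ (3 + m) (G (suc m)) (shift (3 + m) (G (2 + m))))
                                               (⊕-congˡ (shift (3 + m) (G (suc m))) (shift-twice (3 + m) (G (2 + m))))) ⟩
  base ⊕ ∑ˢ (2 + m) F ⊕ (shift (3 + m) (G (suc m)) ⊕ F (2 + m))
    ≈⟨ ⊕-interchange base (∑ˢ (2 + m) F) (shift (3 + m) (G (suc m))) (F (2 + m)) ⟩
  base ⊕ shift (3 + m) (G (suc m)) ⊕ (∑ˢ (2 + m) F ⊕ F (2 + m))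
    ≈⟨ ⊕-cong (≈-sym base-unfold) (≈-sym (∑ˢ-snoc (2 + m) F)) ⟩
  1s ⊖ qpow 1 ⊕ shift 1 (G (suc m)) ⊕ ∑ˢ (3 + m) F
    ∎
  where
  open ≈-Reasoning
  G : ℕ → Series
  G = invPoch 2
  F : ℕ → Series
  F i = shift (2 * suc i) (G i)
  base : Series
  base = 1s ⊖ qpow 1 ⊕ shift 1 (G m)
  shifted-unfold : shift 1 (G (suc m)) ≈ shift 1 (G m) ⊕ shift (3 + m) (G (suc m))
  shifted-unfold = begin
    shift 1 (G (suc m))                                 ≈⟨ shift-cong 1 (invPoch-unfold 1 m) ⟩
    shift 1 (G m ⊕ shift (2 + m) (G (suc m)))           ≈⟨ shift-⊕ 1 (G m) (shift (2 + m) (G (suc m))) ⟩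
    shift 1 (G m) ⊕ shift 1 (shift (2 + m) (G (suc m))) ≈⟨ ⊕-congˡ (shift 1 (G m)) (shift-shift 1 (2 + m) (G (suc m))) ⟩
    shift 1 (G m) ⊕ shift (3 + m) (G (suc m))           ∎
  base-unfold : 1s ⊖ qpow 1 ⊕ shift 1 (G (suc m)) ≈ base ⊕ shift (3 + m) (G (suc m))
  base-unfold = ≈-trans (⊕-congˡ (1s ⊖ qpow 1) shifted-unfold)
                        (λ n → sym (ℤ.+-assoc (1s n ℤ.- qpow 1 n) (shift 1 (G m) n) (shift (3 + m) (G (suc m)) n)))

invPoch2-expand-tail : ∀ m → invPoch 2 (suc m) ≈
  qpow (2 + m) ⊕ invPoch 2 m ⊕ shift (2 * (2 + m)) (invPoch 2 (suc m))
    ⊕ ∑ˢ m (λ i → shift (2 + m + (2 + i)) (invPoch 2 (suc i)))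
invPoch2-expand-tail m = begin
  G (suc m)                                                        ≈⟨ invPoch-unfold 1 m ⟩
  G m ⊕ shift k (G (suc m))                                        ≈⟨ ⊕-congˡ (G m) (shift-cong k telescope) ⟩
  G m ⊕ shift k (1s ⊕ (∑ˢ m H ⊕ H m))                              ≈⟨ ⊕-congˡ (G m) shifted ⟩
  G m ⊕ (qpow k ⊕ (∑ˢ m (shift k ∘ H) ⊕ shift (2 * k) (G (suc m)))) ≈⟨ (λ n → regroup (G m n) (qpow k n) _ _) ⟩
  qpow k ⊕ G m ⊕ shift (2 * k) (G (suc m)) ⊕ ∑ˢ m (shift k ∘ H)
    ≈⟨ ⊕-congˡ (qpow k ⊕ G m ⊕ shift (2 * k) (G (suc m))) (∑ˢ-cong m (λ i → shift-shift k (2 + i) (G (suc i)))) ⟩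
  qpow k ⊕ G m ⊕ shift (2 * k) (G (suc m)) ⊕ ∑ˢ m (λ i → shift (k + (2 + i)) (G (suc i)))
    ∎
  where
  open ≈-Reasoning
  G : ℕ → Series
  G = invPoch 2
  k : ℕ
  k = 2 + m
  H : ℕ → Series
  H i = shift (2 + i) (G (suc i))
  telescope : G (suc m) ≈ 1s ⊕ (∑ˢ m H ⊕ H m)
  telescope = ≈-trans (invPoch2-telescope (suc m)) (⊕-congˡ 1s (∑ˢ-snoc m H))
  shifted : shift k (1s ⊕ (∑ˢ m H ⊕ H m)) ≈ qpow k ⊕ (∑ˢ m (shift k ∘ H) ⊕ shift (2 * k) (G (suc m)))
  shifted = begin
    shift k (1s ⊕ (∑ˢ m H ⊕ H m))
      ≈⟨ ≈-trans (shift-⊕ k 1s (∑ˢ m H ⊕ H m)) (⊕-congˡ (shift k 1s) (shift-⊕ k (∑ˢ m H) (H m))) ⟩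
    shift k 1s ⊕ (shift k (∑ˢ m H) ⊕ shift k (H m))
      ≈⟨ ⊕-cong (≈-sym (qpow≈shift-1s k)) (⊕-cong (shift-∑ˢ k m H) (shift-twice k (G (suc m)))) ⟩
    qpow k ⊕ (∑ˢ m (shift k ∘ H) ⊕ shift (2 * k) (G (suc m)))
      ∎
  regroup : ∀ g q s b → g ℤ.+ (q ℤ.+ (s ℤ.+ b)) ≡ q ℤ.+ g ℤ.+ b ℤ.+ s
  regroup = ℤ-Ring.solve-∀

-- Partitions counted by p_k

Positive : List ℕ → Set
Positive = All (1 ≤_)

Nonincreasing : List ℕ → Set
Nonincreasing = Linked _≥_

≡-irrelevant : {xs ys : List ℕ} (p q : xs ≡ ys) → p ≡ q
≡-irrelevant = Decidable⇒UIP.≡-irrelevant (≡-dec ℕ._≟_)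

LargestTwice-irrelevant : ∀ {xs} (u v : LargestTwice xs) → u ≡ v
LargestTwice-irrelevant (inj₁ refl) (inj₁ q) = cong inj₁ (≡-irrelevant refl q)
LargestTwice-irrelevant (inj₁ refl) (inj₂ (_ , _ , ()))
LargestTwice-irrelevant (inj₂ (_ , _ , refl)) (inj₁ ())
LargestTwice-irrelevant (inj₂ (a , r , refl)) (inj₂ (a′ , r′ , q)) =
  cong inj₂ (same-witness (∷-injectiveˡ q) (∷-injectiveʳ (∷-injectiveʳ q)) q)
  where
  same-witness : ∀ {a′ r′} → a ≡ a′ → r ≡ r′ →
                 (q : a ∷ a ∷ r ≡ a′ ∷ a′ ∷ r′) → (a , r , refl) ≡ (a′ , r′ , q)
  same-witness refl refl q = cong (λ q → a , r , q) (≡-irrelevant refl q)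

PkPartition-≡ : ∀ {k n} {x y : PkPartition k n} → parts x ≡ parts y → x ≡ y
PkPartition-≡ {x = mkPart xs pos dec len s lt} {mkPart .xs pos′ dec′ len′ s′ lt′} refl
  rewrite All.irrelevant ℕ.≤-irrelevant pos pos′ | Linked.irrelevant ℕ.≤-irrelevant dec dec′
        | ℕ.≤-irrelevant len len′ | ℕ.≡-irrelevant s s′ | LargestTwice-irrelevant lt lt′ = refl

bounded⇒nonincreasing-cons : ∀ {x xs} → All (_≤ x) xs → Nonincreasing xs → Nonincreasing (x ∷ xs)
bounded⇒nonincreasing-cons []      _   = [-]
bounded⇒nonincreasing-cons (y≤x ∷ _) dec = y≤x ∷ dec

nonincreasing-cons⇒bounded : ∀ {x xs} → Nonincreasing (x ∷ xs) → All (_≤ x) xs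
nonincreasing-cons⇒bounded [-]         = []
nonincreasing-cons⇒bounded (y≤x ∷ dec) = Linked⇒All (λ p q → ℕ.≤-trans q p) y≤x dec

length≤sum : ∀ {xs} → Positive xs → length xs ≤ sum xs
length≤sum []          = z≤n
length≤sum (1≤x ∷ pos) = ℕ.+-mono-≤ 1≤x (length≤sum pos)

removeColumn : List ℕ → List ℕ
removeColumn []                 = []
removeColumn (zero ∷ xs)        = removeColumn xs
removeColumn (suc zero ∷ xs)    = removeColumn xs
removeColumn (suc (suc a) ∷ xs) = suc a ∷ removeColumn xs

addColumn : ℕ → List ℕ → List ℕ
addColumn zero    xs       = []
addColumn (suc r) []       = 1 ∷ addColumn r []
addColumn (suc r) (x ∷ xs) = suc x ∷ addColumn r xs

removeColumn-positive : ∀ xs → Positive (removeColumn xs)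
removeColumn-positive []                 = []
removeColumn-positive (zero ∷ xs)        = removeColumn-positive xs
removeColumn-positive (suc zero ∷ xs)    = removeColumn-positive xs
removeColumn-positive (suc (suc a) ∷ xs) = s≤s z≤n ∷ removeColumn-positive xs

removeColumn-bounded : ∀ {b} xs → All (_≤ b) xs → All (_≤ pred b) (removeColumn xs)
removeColumn-bounded []                 _               = []
removeColumn-bounded (zero ∷ xs)        (_ ∷ bnd)       = removeColumn-bounded xs bnd
removeColumn-bounded (suc zero ∷ xs)    (_ ∷ bnd)       = removeColumn-bounded xs bnd
removeColumn-bounded (suc (suc a) ∷ xs) (s≤s a<b ∷ bnd) = a<b ∷ removeColumn-bounded xs bnd

removeColumn-nonincreasing : ∀ xs → Nonincreasing xs → Nonincreasing (removeColumn xs)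
removeColumn-nonincreasing []                 _   = []
removeColumn-nonincreasing (zero ∷ xs)        dec = removeColumn-nonincreasing xs (Linked.tail dec)
removeColumn-nonincreasing (suc zero ∷ xs)    dec = removeColumn-nonincreasing xs (Linked.tail dec)
removeColumn-nonincreasing (suc (suc a) ∷ xs) dec =
  bounded⇒nonincreasing-cons (removeColumn-bounded xs (nonincreasing-cons⇒bounded dec))
                             (removeColumn-nonincreasing xs (Linked.tail dec))

removeColumn-length : ∀ xs → length (removeColumn xs) ≤ length xs
removeColumn-length []                 = z≤n
removeColumn-length (zero ∷ xs)        = ℕ.m≤n⇒m≤1+n (removeColumn-length xs)
removeColumn-length (suc zero ∷ xs)    = ℕ.m≤n⇒m≤1+n (removeColumn-length xs)
removeColumn-length (suc (suc a) ∷ xs) = s≤s (removeColumn-length xs)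

removeColumn-sum : ∀ {xs} → Positive xs → length xs + sum (removeColumn xs) ≡ sum xs
removeColumn-sum {[]}                 []        = refl
removeColumn-sum {suc zero ∷ xs}      (_ ∷ pos) = cong suc (removeColumn-sum pos)
removeColumn-sum {suc (suc a) ∷ xs}   (_ ∷ pos) =
  cong suc (trans (swap (length xs) (suc a) _) (cong (_+_ (suc a)) (removeColumn-sum pos)))
  where
  swap : ∀ l b s → l + (b + s) ≡ b + (l + s)
  swap = ℕ-Ring.solve-∀

removeColumn-ones : ∀ {xs} → All (_≤ 1) xs → Positive xs → removeColumn xs ≡ []
removeColumn-ones {[]}              []               []        = refl
removeColumn-ones {suc zero ∷ xs}   (_ ∷ bnd)        (_ ∷ pos) = removeColumn-ones bnd pos
removeColumn-ones {suc (suc _) ∷ _} (s≤s () ∷ _)     _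

removeColumn-largestTwice : ∀ {xs} → Positive xs → Nonincreasing xs →
                            LargestTwice xs → LargestTwice (removeColumn xs)
removeColumn-largestTwice _ _ (inj₁ refl) = inj₁ refl
removeColumn-largestTwice (_ ∷ _ ∷ pos) dec (inj₂ (suc zero , r , refl)) =
  inj₁ (removeColumn-ones (All.tail (nonincreasing-cons⇒bounded dec)) pos)
removeColumn-largestTwice _ _ (inj₂ (suc (suc b) , r , refl)) = inj₂ (suc b , removeColumn r , refl)

addColumn-positive : ∀ r xs → Positive (addColumn r xs)
addColumn-positive zero    xs       = []
addColumn-positive (suc r) []       = s≤s z≤n ∷ addColumn-positive r []
addColumn-positive (suc r) (x ∷ xs) = s≤s z≤n ∷ addColumn-positive r xs

addColumn-bounded : ∀ {b} r xs → All (_≤ b) xs → All (_≤ suc b) (addColumn r xs)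
addColumn-bounded zero    xs       _           = []
addColumn-bounded (suc r) []       _           = s≤s z≤n ∷ addColumn-bounded r [] []
addColumn-bounded (suc r) (x ∷ xs) (x≤b ∷ bnd) = s≤s x≤b ∷ addColumn-bounded r xs bnd

addColumn-nonincreasing : ∀ r xs → Nonincreasing xs → Nonincreasing (addColumn r xs)
addColumn-nonincreasing zero    xs       _   = []
addColumn-nonincreasing (suc r) []       _   =
  bounded⇒nonincreasing-cons (addColumn-bounded {0} r [] []) (addColumn-nonincreasing r [] [])
addColumn-nonincreasing (suc r) (x ∷ xs) dec =
  bounded⇒nonincreasing-cons (addColumn-bounded r xs (nonincreasing-cons⇒bounded dec))
                             (addColumn-nonincreasing r xs (Linked.tail dec))

addColumn-length : ∀ r xs → length xs ≤ r → length (addColumn r xs) ≡ r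
addColumn-length zero    xs       _         = refl
addColumn-length (suc r) []       _         = cong suc (addColumn-length r [] z≤n)
addColumn-length (suc r) (x ∷ xs) (s≤s len) = cong suc (addColumn-length r xs len)

addColumn-sum : ∀ r xs → length xs ≤ r → sum (addColumn r xs) ≡ r + sum xs
addColumn-sum zero    []       _         = refl
addColumn-sum (suc r) []       _         = cong suc (addColumn-sum r [] z≤n)
addColumn-sum (suc r) (x ∷ xs) (s≤s len) =
  cong suc (trans (cong (_+_ x) (addColumn-sum r xs len)) (swap x r (sum xs)))
  where
  swap : ∀ x r s → x + (r + s) ≡ r + (x + s)
  swap = ℕ-Ring.solve-∀

addColumn-largestTwice : ∀ k xs → LargestTwice xs → LargestTwice (addColumn (2 + k) xs)
addColumn-largestTwice k _ (inj₁ refl)            = inj₂ (1 , addColumn k [] , refl)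
addColumn-largestTwice k _ (inj₂ (a , r , refl)) = inj₂ (suc a , addColumn k r , refl)

removeColumn-addColumn : ∀ r {xs} → Positive xs → length xs ≤ r → removeColumn (addColumn r xs) ≡ xs
removeColumn-addColumn zero    {[]}         []        _         = refl
removeColumn-addColumn (suc r) {[]}         []        _         = removeColumn-addColumn r [] z≤n
removeColumn-addColumn (suc r) {suc x ∷ xs} (_ ∷ pos) (s≤s len) =
  cong (suc x ∷_) (removeColumn-addColumn r pos len)

addColumn-ones : ∀ {xs} → All (_≤ 1) xs → Positive xs → addColumn (length xs) [] ≡ xs
addColumn-ones {[]}              []           []        = refl
addColumn-ones {suc zero ∷ xs}   (_ ∷ bnd)    (_ ∷ pos) = cong (1 ∷_) (addColumn-ones bnd pos)
addColumn-ones {suc (suc _) ∷ _} (s≤s () ∷ _) _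

addColumn-removeColumn : ∀ {xs} → Positive xs → Nonincreasing xs →
                         addColumn (length xs) (removeColumn xs) ≡ xs
addColumn-removeColumn {[]}               []        _   = refl
addColumn-removeColumn {suc zero ∷ xs}    (_ ∷ pos) dec
  rewrite removeColumn-ones (nonincreasing-cons⇒bounded dec) pos =
  cong (1 ∷_) (addColumn-ones (nonincreasing-cons⇒bounded dec) pos)
addColumn-removeColumn {suc (suc a) ∷ xs} (_ ∷ pos) dec =
  cong (suc (suc a) ∷_) (addColumn-removeColumn pos (Linked.tail dec))

PkPartition-1-empty : ∀ {n} (x : PkPartition 1 n) → parts x ≡ []
PkPartition-1-empty (mkPart _ _ _ _ _ (inj₁ empty))                    = empty
PkPartition-1-empty (mkPart _ _ _ (s≤s ()) _ (inj₂ (_ , _ , refl)))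

PkPartition-1-zero↔ : PkPartition 1 0 ↔ Fin 1
PkPartition-1-zero↔ = mk↔ₛ′ (λ _ → Fin.zero) (λ _ → mkPart [] [] [] z≤n refl (inj₁ refl))
  (λ { Fin.zero → refl ; (Fin.suc ()) }) (λ x → PkPartition-≡ (sym (PkPartition-1-empty x)))

PkPartition-1-suc↔ : ∀ n → PkPartition 1 (suc n) ↔ Fin 0
PkPartition-1-suc↔ n = mk↔ₛ′ (⊥-elim ∘ impossible) (λ ()) (λ ()) (⊥-elim ∘ impossible)
  where
  impossible : PkPartition 1 (suc n) → ⊥
  impossible x with parts x | PkPartition-1-empty x | sumIsN x
  ... | _ | refl | ()

-- A partition of n has at most n parts.
PkPartition-shrink↔ : ∀ {k n} → n ≤ k → PkPartition (suc k) n ↔ PkPartition k n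
PkPartition-shrink↔ {k} {n} n≤k =
  mk↔ₛ′ shrink widen (λ _ → PkPartition-≡ refl) (λ _ → PkPartition-≡ refl)
  where
  shrink : PkPartition (suc k) n → PkPartition k n
  shrink (mkPart xs pos dec _ s lt) =
    mkPart xs pos dec (ℕ.≤-trans (ℕ.≤-trans (length≤sum pos) (ℕ.≤-reflexive s)) n≤k) s lt
  widen : PkPartition k n → PkPartition (suc k) n
  widen (mkPart xs pos dec len s lt) = mkPart xs pos dec (ℕ.m≤n⇒m≤1+n len) s lt

-- Partitions with exactly 2+k parts are those obtained by adding a column of height 2+k.
module _ (k m : ℕ) where
  private
    N : ℕ
    N = 2 + k + m

  split : (x : PkPartition (2 + k) N) → Dec (length (parts x) ≤ suc k) →
          PkPartition (suc k) N ⊎ PkPartition (2 + k) m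
  split (mkPart xs pos dec len s lt) (yes short) = inj₁ (mkPart xs pos dec short s lt)
  split (mkPart xs pos dec len s lt) (no long)   =
    inj₂ (mkPart (removeColumn xs) (removeColumn-positive xs) (removeColumn-nonincreasing xs dec)
                 (ℕ.≤-trans (removeColumn-length xs) len) remaining (removeColumn-largestTwice pos dec lt))
    where
    remaining : sum (removeColumn xs) ≡ m
    remaining = ℕ.+-cancelˡ-≡ (2 + k) _ _ (begin
      2 + k + sum (removeColumn xs)       ≡⟨ cong (_+ sum (removeColumn xs)) (ℕ.≤-antisym len (ℕ.≰⇒> long)) ⟨
      length xs + sum (removeColumn xs)   ≡⟨ removeColumn-sum pos ⟩
      sum xs                              ≡⟨ s ⟩
      2 + k + m                           ∎)
      where open ≡-Reasoning

  unsplit : PkPartition (suc k) N ⊎ PkPartition (2 + k) m → PkPartition (2 + k) N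
  unsplit (inj₁ (mkPart xs pos dec len s lt)) = mkPart xs pos dec (ℕ.m≤n⇒m≤1+n len) s lt
  unsplit (inj₂ (mkPart xs pos dec len s lt)) =
    mkPart (addColumn (2 + k) xs) (addColumn-positive (2 + k) xs) (addColumn-nonincreasing (2 + k) xs dec)
           (ℕ.≤-reflexive (addColumn-length (2 + k) xs len))
           (trans (addColumn-sum (2 + k) xs len) (cong (_+_ (2 + k)) s)) (addColumn-largestTwice k xs lt)

  split-unsplit : ∀ y → split (unsplit y) (length (parts (unsplit y)) ≤? suc k) ≡ y
  split-unsplit (inj₁ (mkPart xs _ _ len _ _)) with length xs ≤? suc k
  ... | yes _    = cong inj₁ (PkPartition-≡ refl)
  ... | no long = contradiction len long
  split-unsplit (inj₂ (mkPart xs pos _ len _ _)) with length (addColumn (2 + k) xs) ≤? suc k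
  ... | yes short =
    contradiction (ℕ.≤-trans (ℕ.≤-reflexive (sym (addColumn-length (2 + k) xs len))) short) (ℕ.<-irrefl refl)
  ... | no _      = cong inj₂ (PkPartition-≡ (removeColumn-addColumn (2 + k) pos len))

  unsplit-split : ∀ x → unsplit (split x (length (parts x) ≤? suc k)) ≡ x
  unsplit-split (mkPart xs pos dec len _ _) with length xs ≤? suc k
  ... | yes _    = PkPartition-≡ refl
  ... | no long = PkPartition-≡ (subst (λ l → addColumn l (removeColumn xs) ≡ xs)
                                       (ℕ.≤-antisym len (ℕ.≰⇒> long)) (addColumn-removeColumn pos dec))

  PkPartition-split↔ : PkPartition (2 + k) N ↔ (PkPartition (suc k) N ⊎ PkPartition (2 + k) m)
  PkPartition-split↔ =
    mk↔ₛ′ (λ x → split x (length (parts x) ≤? suc k)) unsplit split-unsplit unsplit-split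

-- p_2, p_3, p_4 as computed by the recurrence for p_k.
p₂ : ℕ → ℕ
p₂ zero          = 1
p₂ (suc zero)    = 0
p₂ (suc (suc n)) = p₂ n

p₃ : ℕ → ℕ
p₃ zero                = 1
p₃ (suc zero)          = 0
p₃ (suc (suc zero))    = 1
p₃ (suc (suc (suc n))) = p₂ (3 + n) + p₃ n

p₄ : ℕ → ℕ
p₄ zero                      = 1
p₄ (suc zero)                = 0
p₄ (suc (suc zero))          = 1
p₄ (suc (suc (suc zero)))    = 1
p₄ (suc (suc (suc (suc n)))) = p₃ (4 + n) + p₄ n

p₂-mod : ∀ n → p₂ n ≡ p₂ (n % 2)
p₂-mod zero          = refl
p₂-mod (suc zero)    = refl
p₂-mod (suc (suc n)) = p₂-mod n

p₂-consecutive : ∀ n → p₂ n + p₂ (suc n) ≡ 1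
p₂-consecutive zero          = refl
p₂-consecutive (suc zero)    = refl
p₂-consecutive (suc (suc n)) = p₂-consecutive n

p₃-six : ∀ n → p₃ (6 + n) ≡ suc (p₃ n)
p₃-six n = trans (sym (ℕ.+-assoc (p₂ n) (p₂ (suc n)) (p₃ n))) (cong (_+ p₃ n) (p₂-consecutive n))

p₃-divmod : ∀ n → p₃ n ≡ n / 6 + p₃ (n % 6)
p₃-divmod 0 = refl
p₃-divmod 1 = refl
p₃-divmod 2 = refl
p₃-divmod 3 = refl
p₃-divmod 4 = refl
p₃-divmod 5 = refl
p₃-divmod (suc (suc (suc (suc (suc (suc n)))))) = begin
  p₃ (6 + n)                  ≡⟨ p₃-six n ⟩
  suc (p₃ n)                  ≡⟨ cong suc (p₃-divmod n) ⟩
  suc (n / 6 + p₃ (n % 6))    ≡⟨ cong (_+ p₃ (n % 6)) (m/n≡1+[m∸n]/n {6 + n} {6} (ℕ.m≤m+n 6 n)) ⟨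
  (6 + n) / 6 + p₃ (n % 6)    ∎
  where open ≡-Reasoning

p₃-residue : ∀ r → r < 6 → r ≢ 1 → p₃ r ≡ 1
p₃-residue 0 _ _   = refl
p₃-residue 1 _ r≢1 = contradiction refl r≢1
p₃-residue 2 _ _   = refl
p₃-residue 3 _ _   = refl
p₃-residue 4 _ _   = refl
p₃-residue 5 _ _   = refl
p₃-residue (suc (suc (suc (suc (suc (suc _)))))) (s≤s (s≤s (s≤s (s≤s (s≤s (s≤s ())))))) _

p₃-twelve : ∀ n → p₃ (12 + n) ≡ 2 + p₃ n
p₃-twelve n = trans (p₃-six (6 + n)) (cong suc (p₃-six n))

Δ₄ : ℕ → ℕ
Δ₄ n = p₃ (12 + n) + (p₃ (8 + n) + p₃ (4 + n))

p₄-twelve : ∀ n → p₄ (12 + n) ≡ Δ₄ n + p₄ n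
p₄-twelve n = begin
  p₃ (12 + n) + (p₃ (8 + n) + (p₃ (4 + n) + p₄ n))
    ≡⟨ cong (_+_ (p₃ (12 + n))) (ℕ.+-assoc (p₃ (8 + n)) (p₃ (4 + n)) (p₄ n)) ⟨
  p₃ (12 + n) + (p₃ (8 + n) + p₃ (4 + n) + p₄ n)
    ≡⟨ ℕ.+-assoc (p₃ (12 + n)) (p₃ (8 + n) + p₃ (4 + n)) (p₄ n) ⟨
  Δ₄ n + p₄ n
    ∎
  where open ≡-Reasoning

Δ₄-twelve : ∀ n → Δ₄ (12 + n) ≡ 6 + Δ₄ n
Δ₄-twelve n = begin
  p₃ (12 + (12 + n)) + (p₃ (8 + (12 + n)) + p₃ (4 + (12 + n)))
    ≡⟨ cong₂ _+_ (p₃-twelve (12 + n)) (cong₂ _+_ (p₃-twelve (8 + n)) (p₃-twelve (4 + n))) ⟩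
  2 + p₃ (12 + n) + (2 + p₃ (8 + n) + (2 + p₃ (4 + n)))
    ≡⟨ collect (p₃ (12 + n)) (p₃ (8 + n)) (p₃ (4 + n)) ⟩
  6 + Δ₄ n ∎
  where
  open ≡-Reasoning
  collect : ∀ x y z → 2 + x + (2 + y + (2 + z)) ≡ 6 + (x + (y + z))
  collect = ℕ-Ring.solve-∀

twelve-times-suc : ∀ a c → 12 * suc a + c ≡ 12 + (12 * a + c)
twelve-times-suc a c = trans (cong (_+ c) (ℕ.*-suc 12 a)) (ℕ.+-assoc 12 (12 * a) c)

Δ₄-closed : ∀ a c → Δ₄ (12 * a + c) ≡ 6 * a + Δ₄ c
Δ₄-closed zero    c = refl
Δ₄-closed (suc a) c = begin
  Δ₄ (12 * suc a + c)       ≡⟨ cong Δ₄ (twelve-times-suc a c) ⟩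
  Δ₄ (12 + (12 * a + c))    ≡⟨ Δ₄-twelve (12 * a + c) ⟩
  6 + Δ₄ (12 * a + c)       ≡⟨ cong (_+_ 6) (Δ₄-closed a c) ⟩
  6 + (6 * a + Δ₄ c)        ≡⟨ ℕ.+-assoc 6 (6 * a) (Δ₄ c) ⟨
  6 + 6 * a + Δ₄ c          ≡⟨ cong (_+ Δ₄ c) (ℕ.*-suc 6 a) ⟨
  6 * suc a + Δ₄ c          ∎
  where open ≡-Reasoning

p₄-closed : ∀ c c′ → Δ₄ c ≡ 3 + c′ → ∀ a → p₄ (12 * a + c) ≡ 3 * a * a + c′ * a + p₄ c
p₄-closed c c′ Δ₄c zero    = cong (_+ p₄ c) (sym (ℕ.*-zeroʳ c′))
p₄-closed c c′ Δ₄c (suc a) = begin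
  p₄ (12 * suc a + c)
    ≡⟨ cong p₄ (twelve-times-suc a c) ⟩
  p₄ (12 + (12 * a + c))
    ≡⟨ p₄-twelve (12 * a + c) ⟩
  Δ₄ (12 * a + c) + p₄ (12 * a + c)
    ≡⟨ cong₂ _+_ (trans (Δ₄-closed a c) (cong (_+_ (6 * a)) Δ₄c)) (p₄-closed c c′ Δ₄c a) ⟩
  6 * a + (3 + c′) + (3 * a * a + c′ * a + p₄ c)
    ≡⟨ square a c′ (p₄ c) ⟩
  3 * suc a * suc a + c′ * suc a + p₄ c
    ∎
  where
  open ≡-Reasoning
  square : ∀ a c′ d →
           6 * a + (3 + c′) + (3 * a * a + c′ * a + d) ≡ 3 * suc a * suc a + c′ * suc a + d
  square = ℕ-Ring.solve-∀

module Counting (p : ℕ → ℕ → ℕ) (p-counts : ∀ k n → Fin (p k n) ↔ PkPartition k n) where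

  p-≡ : ∀ {k n a} → PkPartition k n ↔ Fin a → p k n ≡ a
  p-≡ e = ↔⇒≡ (↔-trans (p-counts _ _) e)

  p-1-zero : p 1 0 ≡ 1
  p-1-zero = p-≡ PkPartition-1-zero↔

  p-1-suc : ∀ n → p 1 (suc n) ≡ 0
  p-1-suc n = p-≡ (PkPartition-1-suc↔ n)

  p-shrink : ∀ {k n} → n ≤ k → p (suc k) n ≡ p k n
  p-shrink n≤k = p-≡ (↔-trans (PkPartition-shrink↔ n≤k) (↔-sym (p-counts _ _)))

  p-split : ∀ k m → p (2 + k) (2 + k + m) ≡ p (suc k) (2 + k + m) + p (2 + k) m
  p-split k m = p-≡ (↔-trans (PkPartition-split↔ k m)
                             (↔-trans (↔-sym (p-counts _ _) ⊎-↔ ↔-sym (p-counts _ _)) (↔-sym +↔⊎)))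

  p-2≡p₂ : ∀ n → p 2 n ≡ p₂ n
  p-2≡p₂ zero          = trans (p-shrink z≤n) p-1-zero
  p-2≡p₂ (suc zero)    = trans (p-shrink (s≤s z≤n)) (p-1-suc 0)
  p-2≡p₂ (suc (suc n)) = trans (p-split 0 n) (cong₂ _+_ (p-1-suc (suc n)) (p-2≡p₂ n))

  p-3≡p₃ : ∀ n → p 3 n ≡ p₃ n
  p-3≡p₃ zero                = trans (p-shrink z≤n) (p-2≡p₂ 0)
  p-3≡p₃ (suc zero)          = trans (p-shrink (s≤s z≤n)) (p-2≡p₂ 1)
  p-3≡p₃ (suc (suc zero))    = trans (p-shrink (s≤s (s≤s z≤n))) (p-2≡p₂ 2)
  p-3≡p₃ (suc (suc (suc n))) = trans (p-split 1 n) (cong₂ _+_ (p-2≡p₂ (3 + n)) (p-3≡p₃ n))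

  p-4≡p₄ : ∀ n → p 4 n ≡ p₄ n
  p-4≡p₄ zero                      = trans (p-shrink z≤n) (p-3≡p₃ 0)
  p-4≡p₄ (suc zero)                = trans (p-shrink (s≤s z≤n)) (p-3≡p₃ 1)
  p-4≡p₄ (suc (suc zero))          = trans (p-shrink (s≤s (s≤s z≤n))) (p-3≡p₃ 2)
  p-4≡p₄ (suc (suc (suc zero)))    = trans (p-shrink (s≤s (s≤s (s≤s z≤n)))) (p-3≡p₃ 3)
  p-4≡p₄ (suc (suc (suc (suc n)))) = trans (p-split 2 n) (cong₂ _+_ (p-3≡p₃ (4 + n)) (p-4≡p₄ n))

  P : ℕ → Series
  P k n = + p k n

  P-unfold : ∀ k → P (2 + k) ≈ P (suc k) ⊕ shift (2 + k) (P (2 + k))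
  P-unfold k n with offset (2 + k) n
  ... | below n<k = begin
    P (2 + k) n                                ≡⟨ cong +_ (p-shrink (ℕ.≤-pred n<k)) ⟩
    P (suc k) n                                ≡⟨ ℤ.+-identityʳ (P (suc k) n) ⟨
    P (suc k) n ℤ.+ + 0                        ≡⟨ cong (ℤ._+_ (P (suc k) n)) (shift-< (2 + k) (P (2 + k)) n<k) ⟨
    P (suc k) n ℤ.+ shift (2 + k) (P (2 + k)) n ∎
    where open ≡-Reasoning
  ... | above m   =
    trans (cong +_ (p-split k m)) (cong (ℤ._+_ (P (suc k) (2 + k + m))) (sym (shift-+ (2 + k) (P (2 + k)) m)))

  P≈invPoch : ∀ m → P (suc m) ≈ invPoch 2 m
  P≈invPoch zero    zero    = cong +_ p-1-zero
  P≈invPoch zero    (suc n) = cong +_ (p-1-suc n)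
  P≈invPoch (suc m) = shift-fixpoint-unique (suc m) (invPoch 2 m)
    (λ n → trans (P-unfold m n) (cong (ℤ._+ shift (2 + m) (P (2 + m)) n) (P≈invPoch m n)))
    (invPoch-unfold 1 m)

  p-2-parity : ∀ n → (n % 2 ≡ 0 → p 2 n ≡ 1) × (n % 2 ≡ 1 → p 2 n ≡ 0)
  p-2-parity n = (λ even → trans p-2-mod (cong p₂ even)) , (λ odd → trans p-2-mod (cong p₂ odd))
    where
    p-2-mod : p 2 n ≡ p₂ (n % 2)
    p-2-mod = trans (p-2≡p₂ n) (p₂-mod n)

  p-3-formula : ∀ n → (n % 6 ≢ 1 → p 3 n ≡ n / 6 + 1) × (n % 6 ≡ 1 → p 3 n ≡ n / 6)
  p-3-formula n = (λ r≢1 → trans p-3-divmod (cong (_+_ (n / 6)) (p₃-residue (n % 6) (m%n<n n 6) r≢1)))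
                , (λ r≡1 → trans p-3-divmod (trans (cong (λ r → n / 6 + p₃ r) r≡1) (ℕ.+-identityʳ (n / 6))))
    where
    p-3-divmod : p 3 n ≡ n / 6 + p₃ (n % 6)
    p-3-divmod = trans (p-3≡p₃ n) (p₃-divmod n)

  p-4-closed : ∀ c c′ → Δ₄ c ≡ 3 + c′ → ∀ a → p 4 (12 * a + c) ≡ 3 * a * a + c′ * a + p₄ c
  p-4-closed c c′ Δ₄c a = trans (p-4≡p₄ (12 * a + c)) (p₄-closed c c′ Δ₄c a)

  P-generating-functions : ∀ k → 2 ≤ k →
        (P k ≈ invPoch 2 (k ∸ 1))
      × (P k ≈ 1s ⊕ sumFromTo 2 k (λ j → qpow j ⊛ invPoch j (k ∸ j + 1)))
      × (P k ≈ 1s ⊖ qpow 1 ⊕ qpow 1 ⊛ invPoch 2 (k ∸ 2) ⊕ sumFromTo 1 k (λ j → qpow (2 * j) ⊛ invPoch 2 (j ∸ 1)))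
      × (P k ≈ qpow k ⊕ invPoch 2 (k ∸ 2) ⊕ qpow (2 * k) ⊛ invPoch 2 (k ∸ 1)
                 ⊕ sumFromTo 2 (k ∸ 1) (λ j → qpow (k + j) ⊛ invPoch 2 (j ∸ 1)))
  P-generating-functions (suc (suc m)) (s≤s (s≤s _)) =
      P≈invPoch (suc m)
    , ≈-trans (P≈invPoch (suc m)) (≈-trans (invPoch-expand 1 m)
        (⊕-congˡ 1s (≈-sym (sumFromTo-qpow-⊛ 2 k (λ j → j) (λ j → invPoch j (k ∸ j + 1))))))
    , ≈-trans (P≈invPoch (suc m)) (≈-trans (invPoch2-expand-squares m)
        (≈-sym (⊕-cong (⊕-congˡ (1s ⊖ qpow 1) (qpow-⊛ 1 (invPoch 2 m)))
                       (sumFromTo-qpow-⊛ 1 k (2 *_) (λ j → invPoch 2 (j ∸ 1))))))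
    , ≈-trans (P≈invPoch (suc m)) (≈-trans (invPoch2-expand-tail m)
        (≈-sym (⊕-cong (⊕-congˡ (qpow k ⊕ invPoch 2 m) (qpow-⊛ (2 * k) (invPoch 2 (suc m))))
                       (sumFromTo-qpow-⊛ 2 (suc m) (_+_ k) (λ j → invPoch 2 (j ∸ 1))))))
    where
    k : ℕ
    k = 2 + m

lemma2p1 : (p : ℕ → ℕ → ℕ) → (∀ k n → Fin (p k n) ↔ PkPartition k n) →
  -- (1)
  (∀ n → (n % 2 ≡ 0 → p 2 n ≡ 1) × (n % 2 ≡ 1 → p 2 n ≡ 0))
  -- (2)
  × (∀ n → (n % 6 ≢ 1 → p 3 n ≡ n / 6 + 1) × (n % 6 ≡ 1 → p 3 n ≡ n / 6))
  -- (3)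
  × (∀ a →
      (p 4 (12 * a) ≡ 3 * a * a + 3 * a + 1) × (p 4 (12 * a + 3) ≡ 3 * a * a + 3 * a + 1)
    × (p 4 (12 * a + 2) ≡ 3 * a * a + 4 * a + 1) × (p 4 (12 * a + 5) ≡ 3 * a * a + 4 * a + 1)
    × (p 4 (12 * a + 4) ≡ 3 * a * a + 5 * a + 2) × (p 4 (12 * a + 7) ≡ 3 * a * a + 5 * a + 2)
    × (p 4 (12 * a + 6) ≡ 3 * a * a + 6 * a + 3) × (p 4 (12 * a + 9) ≡ 3 * a * a + 6 * a + 3)
    × (p 4 (12 * a + 8) ≡ 3 * a * a + 7 * a + 4) × (p 4 (12 * a + 11) ≡ 3 * a * a + 7 * a + 4)
    × (p 4 (12 * a + 10) ≡ 3 * a * a + 8 * a + 5) × (p 4 (12 * a + 13) ≡ 3 * a * a + 8 * a + 5))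
  -- (4)
  × (∀ k → 2 ≤ k →
      ((λ n → + p k n) ≈ invPoch 2 (k ∸ 1))
    × ((λ n → + p k n) ≈ 1s ⊕ sumFromTo 2 k (λ j → qpow j ⊛ invPoch j (k ∸ j + 1)))
    × ((λ n → + p k n) ≈ 1s ⊖ qpow 1 ⊕ qpow 1 ⊛ invPoch 2 (k ∸ 2)
                           ⊕ sumFromTo 1 k (λ j → qpow (2 * j) ⊛ invPoch 2 (j ∸ 1)))
    × ((λ n → + p k n) ≈ qpow k ⊕ invPoch 2 (k ∸ 2) ⊕ qpow (2 * k) ⊛ invPoch 2 (k ∸ 1)
                           ⊕ sumFromTo 2 (k ∸ 1) (λ j → qpow (k + j) ⊛ invPoch 2 (j ∸ 1))))
lemma2p1 p p-counts =
    p-2-parity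
  , p-3-formula
  , (λ a → trans (cong (p 4) (sym (ℕ.+-identityʳ (12 * a)))) (p-4-closed 0 3 refl a)
         , p-4-closed 3 3 refl a , p-4-closed 2 4 refl a , p-4-closed 5 4 refl a
         , p-4-closed 4 5 refl a , p-4-closed 7 5 refl a , p-4-closed 6 6 refl a , p-4-closed 9 6 refl a
         , p-4-closed 8 7 refl a , p-4-closed 11 7 refl a , p-4-closed 10 8 refl a , p-4-closed 13 8 refl a)
  , P-generating-functions
  where open Counting p p-counts
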